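{- Let $K$ be a primary pseudoperfect number and let $p<q$ be primes not dividing $K$. Then $Kpq$ is a primary pseudoperfect number if and only if \[(p-K)(q-K)=K^2+1.\]
   Context: A squarefree positive integer $n$ is a primary pseudoperfect number if $\frac1n+\sum_{p\mid n}\frac1p=1$, the sum running over the prime divisors of $n$. -}

module Defs where

open import Data.Nat as ℕ using (ℕ; zero; suc; _*_; _≤_)
open import Data.Nat.Divisibility using (_∣_; _∣?_)
open import Data.Nat.Primality using (Prime; prime?)
open import Data.Integer using (+_)
open import Data.Rational using (ℚ; _/_; 0ℚ; 1ℚ; _+_)
open import Data.List using (List; filter; upTo; map; foldr)
open import Data.Product using (_×_)
open import Relation.Nullary.Decidable using (_×-dec_)
open import Relation.Binary.PropositionalEquality using (_≡_)

Squarefree : ℕ → Set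
Squarefree n = ∀ d → d * d ∣ n → d ≡ 1

-- reciprocal of a natural number as a rational (value at 0 irrelevant; only used on primes)
recip : ℕ → ℚ
recip zero    = 0ℚ
recip (suc k) = + 1 / suc k

-- the list of prime divisors of n (all lie in [0, n] when n ≥ 1)
primeDivisors : ℕ → List ℕ
primeDivisors n = filter (λ p → prime? p ×-dec p ∣? n) (upTo (suc n))

sumRecipPrimeDivisors : ℕ → ℚ
sumRecipPrimeDivisors n = foldr _+_ 0ℚ (map recip (primeDivisors n))

PrimaryPseudoperfect : ℕ → Set
PrimaryPseudoperfect n = (1 ≤ n) × Squarefree n × (recip n + sumRecipPrimeDivisors n ≡ 1ℚ)

{-# OPTIONS --safe #-}
module Submission where

-- Since p and q are primes not dividing K, the prime divisors of Kpq are those of K together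
-- with p and q, and Kpq is again squarefree.  Subtracting the defining equation of K from that
-- of Kpq leaves 1/(Kpq) + 1/p + 1/q = 1/K, which after clearing denominators is
-- 1 + Kq + Kp = pq, i.e. (p - K)(q - K) = K² + 1.

open import Defs
open import Data.Nat using (ℕ; _<_)
open import Data.Nat.Divisibility using (_∣_)
open import Data.Nat.Primality using (Prime)
open import Data.Integer using (+_; _-_; _+_)
open import Data.Integer as ℤ using ()
open import Data.Nat as ℕ using ()
open import Relation.Nullary using (¬_)
open import Relation.Binary.PropositionalEquality using (_≡_)
open import Function.Bundles using (_⇔_)

open import Level using (Level; 0ℓ)
open import Data.Nat using (zero; suc; pred; _≤_; z≤n; s≤s; NonZero; >-nonZero; >-nonZero⁻¹)
open import Data.Nat.Properties using (*-comm; ≤-refl; m≤n⇒m<n∨m≡n; <⇒≢; <⇒≱; m≤m*n; m≤n*m; m*n≢0)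
open import Data.Nat.Divisibility
  using (_∤_; _∣?_; ∣-refl; ∣-trans; ∣m⇒∣m*n; ∣n⇒∣m*n; ∣⇒≤; >⇒∤; *-pres-∣; *-cancelʳ-∣)
open import Data.Nat.Primality using (prime?; euclidsLemma; prime⇒irreducible; prime⇒nonZero; ¬prime[1])
open import Data.Nat.Coprimality as Coprime using (Coprime; coprime-divisor)
open import Data.Integer.Properties using (pos-*; *-identityˡ; *-zeroʳ; *-cancelˡ-≡; i≡j⇒i-j≡0; i-j≡0⇒i≡j)
open import Data.Integer.Tactic.RingSolver using (solve-∀)
open import Data.Rational as ℚ using (ℚ; 0ℚ; 1ℚ; toℚᵘ)
open import Data.Rational.Properties
  using (+-identityʳ; +-assoc; +-0-commutativeMonoid; +-0-abelianGroup;
         toℚᵘ-fromℚᵘ; toℚᵘ-homo-+; toℚᵘ-injective; toℚᵘ-cong)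
open import Data.Rational.Solver using (module +-*-Solver)
open import Data.Rational.Unnormalised as ℚᵘ using (ℚᵘ; mkℚᵘ; _≃_; *≡*)
open import Data.Rational.Unnormalised.Properties using (≃-trans; ≃-sym; +-cong)
open import Data.List using (List; []; _∷_; [_]; _++_; _∷ʳ_; filter; map; foldr; upTo)
open import Data.List.Properties
  using (filter-++; filter-accept; filter-reject; filter-none; filter-≐; upTo-∷ʳ; ++-identityʳ)
open import Data.List.Relation.Unary.All as All using ()
open import Data.List.Membership.Propositional.Properties using (∈-upTo⁻)
open import Data.Empty using (⊥-elim)
open import Data.Sum using (inj₁; inj₂; [_,_]′)
open import Data.Product using (_×_; _,_)
open import Function using (id)
open import Function.Bundles using (mk⇔)
open import Function.Properties.Equivalence using () renaming (sym to ⇔-sym; trans to ⇔-trans)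
open import Function.Related.Propositional using (equivalence; module EquationalReasoning)
open import Relation.Nullary using (Dec; yes; no)
open import Relation.Nullary.Decidable using (_×-dec_)
open import Relation.Unary using (Pred; Decidable; _⊆_; _≐_; _∪_; _⊥_)
open import Relation.Unary.Properties using (_∪?_)
open import Relation.Binary.PropositionalEquality using (refl; sym; trans; cong; cong₂; subst; module ≡-Reasoning)
open import Algebra.Bundles using (CommutativeMonoid; AbelianGroup)
open import Algebra.Properties.CommutativeSemigroup (CommutativeMonoid.commutativeSemigroup +-0-commutativeMonoid)
  using (x∙yz≈y∙xz)
open import Algebra.Properties.Group (AbelianGroup.group +-0-abelianGroup) using (∙-cancelʳ)

private
  variable
    ℓ ℓ′ : Level
    P : Pred ℕ ℓ
    Q : Pred ℕ ℓ′

sumRecips : List ℕ → ℚ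
sumRecips xs = foldr ℚ._+_ 0ℚ (map recip xs)

module _ (P? : Decidable P) where

  filter-upTo-suc : ∀ n → filter P? (upTo (suc n)) ≡ filter P? (upTo n) ++ filter P? [ n ]
  filter-upTo-suc n = begin
    filter P? (upTo (suc n))              ≡⟨ cong (filter P?) (upTo-∷ʳ n) ⟨
    filter P? (upTo n ∷ʳ n)               ≡⟨ filter-++ P? (upTo n) [ n ] ⟩
    filter P? (upTo n) ++ filter P? [ n ] ∎
    where open ≡-Reasoning

  filter-upTo-bounded : ∀ {m n} → P ⊆ (_< m) → m ≤ n → filter P? (upTo n) ≡ filter P? (upTo m)
  filter-upTo-bounded {n = zero}  P<m z≤n = refl
  filter-upTo-bounded {m} {suc n} P<m m≤1+n with m≤n⇒m<n∨m≡n m≤1+n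
  ... | inj₂ refl      = refl
  ... | inj₁ (s≤s m≤n) = begin
    filter P? (upTo (suc n))              ≡⟨ filter-upTo-suc n ⟩
    filter P? (upTo n) ++ filter P? [ n ] ≡⟨ cong (filter P? (upTo n) ++_) (filter-reject P? ¬Pn) ⟩
    filter P? (upTo n) ++ []              ≡⟨ ++-identityʳ _ ⟩
    filter P? (upTo n)                    ≡⟨ filter-upTo-bounded P<m m≤n ⟩
    filter P? (upTo m)                    ∎
    where
    open ≡-Reasoning
    ¬Pn : ¬ P n
    ¬Pn Pn = <⇒≱ (P<m Pn) m≤n

filter-≟-upTo : ∀ {p n} → p < n → filter (ℕ._≟ p) (upTo n) ≡ [ p ]
filter-≟-upTo {p} {n} p<n = begin
  filter (ℕ._≟ p) (upTo n)                          ≡⟨ filter-upTo-bounded (ℕ._≟ p) (λ { refl → ≤-refl }) p<n ⟩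
  filter (ℕ._≟ p) (upTo (suc p))                    ≡⟨ filter-upTo-suc (ℕ._≟ p) p ⟩
  filter (ℕ._≟ p) (upTo p) ++ filter (ℕ._≟ p) [ p ] ≡⟨ cong₂ _++_ below-p (filter-accept (ℕ._≟ p) refl) ⟩
  [ p ]                                             ∎
  where
  open ≡-Reasoning
  below-p : filter (ℕ._≟ p) (upTo p) ≡ []
  below-p = filter-none (ℕ._≟ p) (All.tabulate (λ i∈ → <⇒≢ (∈-upTo⁻ i∈)))

sumRecips-filter-∪ : (P? : Decidable P) (Q? : Decidable Q) → P ⊥ Q → ∀ xs →
  sumRecips (filter (P? ∪? Q?) xs) ≡ sumRecips (filter P? xs) ℚ.+ sumRecips (filter Q? xs)
sumRecips-filter-∪ P? Q? P⊥Q [] = sym (+-identityʳ 0ℚ)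
sumRecips-filter-∪ {P = P} {Q = Q} P? Q? P⊥Q (x ∷ xs) = split (P? x) (Q? x)
  where
  open ≡-Reasoning
  Σ∪ ΣP ΣQ : ℚ
  Σ∪ = sumRecips (filter (P? ∪? Q?) xs)
  ΣP = sumRecips (filter P? xs)
  ΣQ = sumRecips (filter Q? xs)

  Σ∪≡ΣP+ΣQ : Σ∪ ≡ ΣP ℚ.+ ΣQ
  Σ∪≡ΣP+ΣQ = sumRecips-filter-∪ P? Q? P⊥Q xs

  split : Dec (P x) → Dec (Q x) → sumRecips (filter (P? ∪? Q?) (x ∷ xs))
                                  ≡ sumRecips (filter P? (x ∷ xs)) ℚ.+ sumRecips (filter Q? (x ∷ xs))
  split (yes Px) (yes Qx) = ⊥-elim (P⊥Q (Px , Qx))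
  split (yes Px) (no ¬Qx) = begin
    sumRecips (filter (P? ∪? Q?) (x ∷ xs)) ≡⟨ cong sumRecips (filter-accept (P? ∪? Q?) (inj₁ Px)) ⟩
    recip x ℚ.+ Σ∪                          ≡⟨ cong (recip x ℚ.+_) Σ∪≡ΣP+ΣQ ⟩
    recip x ℚ.+ (ΣP ℚ.+ ΣQ)                 ≡⟨ +-assoc (recip x) ΣP ΣQ ⟨
    (recip x ℚ.+ ΣP) ℚ.+ ΣQ                 ≡⟨ cong₂ ℚ._+_ (cong sumRecips (filter-accept P? Px))
                                                            (cong sumRecips (filter-reject Q? ¬Qx)) ⟨
    sumRecips (filter P? (x ∷ xs)) ℚ.+ sumRecips (filter Q? (x ∷ xs)) ∎
  split (no ¬Px) (yes Qx) = begin
    sumRecips (filter (P? ∪? Q?) (x ∷ xs)) ≡⟨ cong sumRecips (filter-accept (P? ∪? Q?) (inj₂ Qx)) ⟩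
    recip x ℚ.+ Σ∪                          ≡⟨ cong (recip x ℚ.+_) Σ∪≡ΣP+ΣQ ⟩
    recip x ℚ.+ (ΣP ℚ.+ ΣQ)                 ≡⟨ x∙yz≈y∙xz (recip x) ΣP ΣQ ⟩
    ΣP ℚ.+ (recip x ℚ.+ ΣQ)                 ≡⟨ cong₂ ℚ._+_ (cong sumRecips (filter-reject P? ¬Px))
                                                            (cong sumRecips (filter-accept Q? Qx)) ⟨
    sumRecips (filter P? (x ∷ xs)) ℚ.+ sumRecips (filter Q? (x ∷ xs)) ∎
  split (no ¬Px) (no ¬Qx) = begin
    sumRecips (filter (P? ∪? Q?) (x ∷ xs)) ≡⟨ cong sumRecips (filter-reject (P? ∪? Q?) [ ¬Px , ¬Qx ]′) ⟩
    Σ∪                                      ≡⟨ Σ∪≡ΣP+ΣQ ⟩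
    ΣP ℚ.+ ΣQ                               ≡⟨ cong₂ ℚ._+_ (cong sumRecips (filter-reject P? ¬Px))
                                                            (cong sumRecips (filter-reject Q? ¬Qx)) ⟨
    sumRecips (filter P? (x ∷ xs)) ℚ.+ sumRecips (filter Q? (x ∷ xs)) ∎

PrimeDivisor : ℕ → Pred ℕ 0ℓ
PrimeDivisor n d = Prime d × d ∣ n

primeDivisor? : ∀ n → Decidable (PrimeDivisor n)
primeDivisor? n d = prime? d ×-dec d ∣? n

primeDivisor⇒< : ∀ {n} .{{_ : NonZero n}} → PrimeDivisor n ⊆ (_< suc n)
primeDivisor⇒< (_ , d∣n) = s≤s (∣⇒≤ d∣n)

prime∣prime⇒≡ : ∀ {d p} → Prime d → Prime p → d ∣ p → d ≡ p
prime∣prime⇒≡ pd pp d∣p with prime⇒irreducible pp d∣p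
... | inj₁ refl = ⊥-elim (¬prime[1] pd)
... | inj₂ d≡p  = d≡p

primeDivisor-*-prime : ∀ {n p} → Prime p → PrimeDivisor (n ℕ.* p) ≐ PrimeDivisor n ∪ (_≡ p)
primeDivisor-*-prime {n} {p} pp = to , from
  where
  to : PrimeDivisor (n ℕ.* p) ⊆ PrimeDivisor n ∪ (_≡ p)
  to (pd , d∣np) with euclidsLemma n p pd d∣np
  ... | inj₁ d∣n = inj₁ (pd , d∣n)
  ... | inj₂ d∣p = inj₂ (prime∣prime⇒≡ pd pp d∣p)
  from : PrimeDivisor n ∪ (_≡ p) ⊆ PrimeDivisor (n ℕ.* p)
  from (inj₁ (pd , d∣n)) = pd , ∣m⇒∣m*n p d∣n
  from (inj₂ refl)       = pp , ∣n⇒∣m*n n ∣-refl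

sumRecipPrimeDivisors-*-prime : ∀ {n p} .{{_ : NonZero n}} → Prime p → p ∤ n →
  sumRecipPrimeDivisors (n ℕ.* p) ≡ sumRecipPrimeDivisors n ℚ.+ recip p
sumRecipPrimeDivisors-*-prime {n} {p} pp p∤n = begin
  sumRecips (filter (primeDivisor? (n ℕ.* p)) range)
    ≡⟨ cong sumRecips (filter-≐ (primeDivisor? (n ℕ.* p)) (primeDivisor? n ∪? (ℕ._≟ p))
                                (primeDivisor-*-prime pp) range) ⟩
  sumRecips (filter (primeDivisor? n ∪? (ℕ._≟ p)) range)
    ≡⟨ sumRecips-filter-∪ (primeDivisor? n) (ℕ._≟ p) (λ { ((_ , p∣n) , refl) → p∤n p∣n }) range ⟩
  sumRecips (filter (primeDivisor? n) range) ℚ.+ sumRecips (filter (ℕ._≟ p) range)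
    ≡⟨ cong₂ ℚ._+_ (cong sumRecips (filter-upTo-bounded (primeDivisor? n) primeDivisor⇒< (s≤s (m≤m*n n p))))
                   (trans (cong sumRecips (filter-≟-upTo (s≤s (m≤n*m p n)))) (+-identityʳ (recip p))) ⟩
  sumRecipPrimeDivisors n ℚ.+ recip p ∎
  where
  open ≡-Reasoning
  instance
    p≢0 : NonZero p
    p≢0 = prime⇒nonZero pp
  range : List ℕ
  range = upTo (suc (n ℕ.* p))

prime∤⇒coprime : ∀ {p m} → Prime p → p ∤ m → Coprime p m
prime∤⇒coprime pp p∤m (d∣p , d∣m) with prime⇒irreducible pp d∣p
... | inj₁ d≡1 = d≡1
... | inj₂ refl = ⊥-elim (p∤m d∣m)

prime∤* : ∀ {p m n} → Prime p → p ∤ m → p ∤ n → p ∤ m ℕ.* n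
prime∤* pp p∤m p∤n p∣mn = [ p∤m , p∤n ]′ (euclidsLemma _ _ pp p∣mn)

squarefree-*-prime : ∀ {n p} → Squarefree n → Prime p → p ∤ n → Squarefree (n ℕ.* p)
squarefree-*-prime {n} {p} sqf pp p∤n d d²∣np =
  sqf d (coprime-divisor (Coprime.sym (prime∤⇒coprime pp p∤d²)) (subst (d ℕ.* d ∣_) (*-comm n p) d²∣np))
  where
  p∤d² : p ∤ d ℕ.* d
  p∤d² p∣d² = p∤n (*-cancelʳ-∣ p {{prime⇒nonZero pp}} (∣-trans (*-pres-∣ p∣d p∣d) d²∣np))
    where p∣d = [ id , id ]′ (euclidsLemma d d pp p∣d²)

recipᵘ : ℕ → ℚᵘ
recipᵘ n = mkℚᵘ (+ 1) (pred n)

toℚᵘ-recip : ∀ n .{{_ : NonZero n}} → toℚᵘ (recip n) ≃ recipᵘ n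
toℚᵘ-recip n@(suc _) = toℚᵘ-fromℚᵘ (recipᵘ n)

recip+recip+recip≡recip⇔ : ∀ a b c d →
  .{{_ : NonZero a}} .{{_ : NonZero b}} .{{_ : NonZero c}} .{{_ : NonZero d}} →
  (recip a ℚ.+ recip b ℚ.+ recip c ≡ recip d)
    ⇔ (+ d ℤ.* (+ b ℤ.* + c + + a ℤ.* + c + + a ℤ.* + b) ≡ + a ℤ.* + b ℤ.* + c)
recip+recip+recip≡recip⇔ a@(suc _) b@(suc _) c@(suc _) d@(suc _) = mk⇔
  (λ e → fromℚᵘ-equation (≃-trans (≃-sym sumᵘ) (≃-trans (toℚᵘ-cong e) (toℚᵘ-recip d))))
  (λ e → toℚᵘ-injective (≃-trans sumᵘ (≃-trans (toℚᵘ-equation e) (≃-sym (toℚᵘ-recip d)))))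
  where
  Cleared : Set
  Cleared = + d ℤ.* (+ b ℤ.* + c + + a ℤ.* + c + + a ℤ.* + b) ≡ + a ℤ.* + b ℤ.* + c

  sumᵘ : toℚᵘ (recip a ℚ.+ recip b ℚ.+ recip c) ≃ recipᵘ a ℚᵘ.+ recipᵘ b ℚᵘ.+ recipᵘ c
  sumᵘ = ≃-trans (toℚᵘ-homo-+ (recip a ℚ.+ recip b) (recip c))
           (+-cong (≃-trans (toℚᵘ-homo-+ (recip a) (recip b)) (+-cong (toℚᵘ-recip a) (toℚᵘ-recip b)))
                   (toℚᵘ-recip c))

  -- Equality in ℚᵘ is cross-multiplication by definition, so the unnormalised equation is
  -- Cleared up to the regrouping below.
  regroup : ∀ A B C D → D ℤ.* (B ℤ.* C + A ℤ.* C + A ℤ.* B)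
                      ≡ ((+ 1 ℤ.* B + + 1 ℤ.* A) ℤ.* C + + 1 ℤ.* (A ℤ.* B)) ℤ.* D
  regroup = solve-∀

  lhs : + d ℤ.* (+ b ℤ.* + c + + a ℤ.* + c + + a ℤ.* + b)
      ≡ ((+ 1 ℤ.* + b + + 1 ℤ.* + a) ℤ.* + c + + 1 ℤ.* + (a ℕ.* b)) ℤ.* + d
  lhs = trans (regroup (+ a) (+ b) (+ c) (+ d))
              (cong (λ ab → ((+ 1 ℤ.* + b + + 1 ℤ.* + a) ℤ.* + c + + 1 ℤ.* ab) ℤ.* + d) (sym (pos-* a b)))

  rhs : + a ℤ.* + b ℤ.* + c ≡ + 1 ℤ.* + (a ℕ.* b ℕ.* c)
  rhs = begin
    + a ℤ.* + b ℤ.* + c          ≡⟨ cong (ℤ._* + c) (pos-* a b) ⟨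
    + (a ℕ.* b) ℤ.* + c          ≡⟨ pos-* (a ℕ.* b) c ⟨
    + (a ℕ.* b ℕ.* c)            ≡⟨ *-identityˡ _ ⟨
    + 1 ℤ.* + (a ℕ.* b ℕ.* c)    ∎
    where open ≡-Reasoning

  fromℚᵘ-equation : recipᵘ a ℚᵘ.+ recipᵘ b ℚᵘ.+ recipᵘ c ≃ recipᵘ d → Cleared
  fromℚᵘ-equation (*≡* e) = trans lhs (trans e (sym rhs))

  toℚᵘ-equation : Cleared → recipᵘ a ℚᵘ.+ recipᵘ b ℚᵘ.+ recipᵘ c ≃ recipᵘ d
  toℚᵘ-equation e = *≡* (trans (sym lhs) (trans e rhs))

x+[s+y+z]≡1⇔x+y+z≡k : ∀ x y z {s k} → k ℚ.+ s ≡ 1ℚ →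
  (x ℚ.+ (s ℚ.+ y ℚ.+ z) ≡ 1ℚ) ⇔ (x ℚ.+ y ℚ.+ z ≡ k)
x+[s+y+z]≡1⇔x+y+z≡k x y z {s} {k} k+s≡1 = begin
  (x ℚ.+ (s ℚ.+ y ℚ.+ z) ≡ 1ℚ)        ≡⟨ cong₂ _≡_ (rearrange x y z s) (sym k+s≡1) ⟩
  (x ℚ.+ y ℚ.+ z ℚ.+ s ≡ k ℚ.+ s)    ∼⟨ mk⇔ (∙-cancelʳ s _ _) (cong (ℚ._+ s)) ⟩
  (x ℚ.+ y ℚ.+ z ≡ k)                ∎
  where
  open EquationalReasoning {k = equivalence}
  rearrange : ∀ x y z s → x ℚ.+ (s ℚ.+ y ℚ.+ z) ≡ x ℚ.+ y ℚ.+ z ℚ.+ s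
  rearrange = solve 4 (λ x y z s → x :+ (s :+ y :+ z) := x :+ y :+ z :+ s) refl
    where open +-*-Solver

i≡j⇔i-j≡0 : ∀ {i j} → (i ≡ j) ⇔ (i - j ≡ + 0)
i≡j⇔i-j≡0 {i} {j} = mk⇔ i≡j⇒i-j≡0 (i-j≡0⇒i≡j i j)

i*j≡0⇔j≡0 : ∀ i {j} .{{_ : ℤ.NonZero i}} → (i ℤ.* j ≡ + 0) ⇔ (j ≡ + 0)
i*j≡0⇔j≡0 i {j} = mk⇔ (λ ij≡0 → *-cancelˡ-≡ i j (+ 0) (trans ij≡0 (sym (*-zeroʳ i))))
                      (λ { refl → *-zeroʳ i })

-- The left-hand side is 1/A + 1/p + 1/q = 1/K with denominators cleared.
cleared⇔[p-K][q-K]≡K²+1 : ∀ {A} K p q → A ≡ K ℤ.* p ℤ.* q → .{{_ : ℤ.NonZero A}} →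
  (K ℤ.* (p ℤ.* q + A ℤ.* q + A ℤ.* p) ≡ A ℤ.* p ℤ.* q) ⇔ ((p - K) ℤ.* (q - K) ≡ K ℤ.* K + + 1)
cleared⇔[p-K][q-K]≡K²+1 {A} K p q refl = begin
  (K ℤ.* (p ℤ.* q + A ℤ.* q + A ℤ.* p) ≡ A ℤ.* p ℤ.* q)       ∼⟨ mk⇔ sym sym ⟩
  (A ℤ.* p ℤ.* q ≡ K ℤ.* (p ℤ.* q + A ℤ.* q + A ℤ.* p))       ∼⟨ i≡j⇔i-j≡0 ⟩
  (A ℤ.* p ℤ.* q - K ℤ.* (p ℤ.* q + A ℤ.* q + A ℤ.* p) ≡ + 0) ≡⟨ cong (_≡ + 0) (factor K p q) ⟩
  (A ℤ.* ((p - K) ℤ.* (q - K) - (K ℤ.* K + + 1)) ≡ + 0)       ∼⟨ i*j≡0⇔j≡0 A ⟩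
  ((p - K) ℤ.* (q - K) - (K ℤ.* K + + 1) ≡ + 0)               ∼⟨ ⇔-sym i≡j⇔i-j≡0 ⟩
  ((p - K) ℤ.* (q - K) ≡ K ℤ.* K + + 1)                       ∎
  where
  open EquationalReasoning {k = equivalence}
  factor : ∀ K p q →
    K ℤ.* p ℤ.* q ℤ.* p ℤ.* q - K ℤ.* (p ℤ.* q + K ℤ.* p ℤ.* q ℤ.* q + K ℤ.* p ℤ.* q ℤ.* p)
      ≡ K ℤ.* p ℤ.* q ℤ.* ((p - K) ℤ.* (q - K) - (K ℤ.* K + + 1))
  factor = solve-∀

primaryPseudoperfect⇔ : ∀ {n} → 1 ≤ n → Squarefree n →
  PrimaryPseudoperfect n ⇔ (recip n ℚ.+ sumRecipPrimeDivisors n ≡ 1ℚ)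
primaryPseudoperfect⇔ 1≤n sqf = mk⇔ (λ (_ , _ , e) → e) (λ e → 1≤n , sqf , e)

mainTheorem4 : (K p q : ℕ) → PrimaryPseudoperfect K → Prime p → Prime q → p < q →
               ¬ (p ∣ K) → ¬ (q ∣ K) →
               (PrimaryPseudoperfect (K ℕ.* p ℕ.* q) ⇔
                 ((+ p - + K) ℤ.* (+ q - + K) ≡ (+ K) ℤ.* (+ K) + + 1))
mainTheorem4 K p q (1≤K , sqf , K-pseudoperfect) pp pq p<q p∤K q∤K =
  ⇔-trans (primaryPseudoperfect⇔ (>-nonZero⁻¹ Kpq) sqf-Kpq) (begin
    (recip Kpq ℚ.+ sumRecipPrimeDivisors Kpq ≡ 1ℚ)
      ≡⟨ cong (λ s → recip Kpq ℚ.+ s ≡ 1ℚ) sum-Kpq ⟩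
    (recip Kpq ℚ.+ (sumRecipPrimeDivisors K ℚ.+ recip p ℚ.+ recip q) ≡ 1ℚ)
      ∼⟨ x+[s+y+z]≡1⇔x+y+z≡k (recip Kpq) (recip p) (recip q) K-pseudoperfect ⟩
    (recip Kpq ℚ.+ recip p ℚ.+ recip q ≡ recip K)
      ∼⟨ recip+recip+recip≡recip⇔ Kpq p q K ⟩
    (+ K ℤ.* (+ p ℤ.* + q + + Kpq ℤ.* + q + + Kpq ℤ.* + p) ≡ + Kpq ℤ.* + p ℤ.* + q)
      ∼⟨ cleared⇔[p-K][q-K]≡K²+1 (+ K) (+ p) (+ q) +Kpq≡+K*+p*+q ⟩
    ((+ p - + K) ℤ.* (+ q - + K) ≡ + K ℤ.* + K + + 1) ∎)
  where
  open EquationalReasoning {k = equivalence}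
  Kpq : ℕ
  Kpq = K ℕ.* p ℕ.* q
  instance
    K≢0 : NonZero K
    K≢0 = >-nonZero 1≤K
    p≢0 : NonZero p
    p≢0 = prime⇒nonZero pp
    q≢0 : NonZero q
    q≢0 = prime⇒nonZero pq
    Kp≢0 : NonZero (K ℕ.* p)
    Kp≢0 = m*n≢0 K p
    Kpq≢0 : NonZero Kpq
    Kpq≢0 = m*n≢0 (K ℕ.* p) q

  +Kpq≡+K*+p*+q : + Kpq ≡ + K ℤ.* + p ℤ.* + q
  +Kpq≡+K*+p*+q = trans (pos-* (K ℕ.* p) q) (cong (ℤ._* + q) (pos-* K p))

  q∤Kp : q ∤ K ℕ.* p
  q∤Kp = prime∤* pq q∤K (>⇒∤ p<q)

  sqf-Kpq : Squarefree Kpq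
  sqf-Kpq = squarefree-*-prime (squarefree-*-prime sqf pp p∤K) pq q∤Kp

  sum-Kpq : sumRecipPrimeDivisors Kpq ≡ sumRecipPrimeDivisors K ℚ.+ recip p ℚ.+ recip q
  sum-Kpq = trans (sumRecipPrimeDivisors-*-prime pq q∤Kp)
                  (cong (ℚ._+ recip q) (sumRecipPrimeDivisors-*-prime pp p∤K))
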